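{- For every $\varphi\in\mathcal{L}_{RS}$: (a) for every $S\subseteq A$, $S\in I(\varphi)$ if and only if there is a process $p$ with $I(p)=S$ and $p\models\varphi$; (b) $\varphi$ is unsatisfiable if and only if $I(\varphi)=\emptyset$.
   Context: Processes are states of finite labelled transition systems $(P,A,\to)$ with $A$ a finite nonempty action set; $I(p)=\{a\in A: p\xrightarrow{a}p'\text{ for some }p'\}$. $\mathcal{L}_{RS}$ is given by $\varphi::=\mathbf{tt}\mid\mathbf{ff}\mid\varphi\wedge\varphi\mid\varphi\vee\varphi\mid\langle a\rangle\varphi\mid[a]\mathbf{ff}$ ($a\in A$) with the usual semantics. For $\varphi\in\mathcal{L}_{RS}$, the set $I(\varphi)\subseteq 2^A$ is defined inductively: $I(\mathbf{tt})=2^A$; $I(\mathbf{ff})=\emptyset$; $I([a]\mathbf{ff})=\{X\subseteq A: a\notin X\}$; $I(\langle a\rangle\varphi)=\emptyset$ if $I(\varphi)=\emptyset$ and $\{X\subseteq A: a\in X\}$ otherwise; $I(\varphi_1\vee\varphi_2)=I(\varphi_1)\cup I(\varphi_2)$; $I(\varphi_1\wedge\varphi_2)=I(\varphi_1)\cap I(\varphi_2)$. A formula is unsatisfiable if no process of any finite LTS satisfies it. -}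

module Defs where

open import Data.Nat using (ℕ; suc)
open import Data.Fin using (Fin)
open import Data.Fin.Subset using (Subset; _∈_; _∉_)
open import Data.Bool using (Bool; true)
open import Data.Product using (_×_; Σ; ∃; ∃-syntax)
open import Data.Sum using (_⊎_)
open import Data.Unit using (⊤)
open import Data.Empty using (⊥)
open import Relation.Nullary using (¬_)
open import Relation.Binary.PropositionalEquality using (_≡_)
open import Function.Bundles using (_⇔_)

-- The action set A is the finite nonempty set Fin (suc k).
Act : ℕ → Set
Act k = Fin (suc k)

record LTS (k : ℕ) : Set where
  field
    states : ℕ
    step   : Fin states → Act k → Fin states → Bool

open LTS public

_⊢_─[_]→_ : ∀ {k} (L : LTS k) → Fin (states L) → Act k → Fin (states L) → Set
L ⊢ p ─[ a ]→ p' = step L p a p' ≡ true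

InitialsEq : ∀ {k} (L : LTS k) → Fin (states L) → Subset (suc k) → Set
InitialsEq {k} L p S = (a : Act k) → (a ∈ S) ⇔ (∃[ p' ] (L ⊢ p ─[ a ]→ p'))

data Form (k : ℕ) : Set where
  tt ff : Form k
  _∧'_ _∨'_ : Form k → Form k → Form k
  ⟨_⟩_ : Act k → Form k → Form k
  [_]ff : Act k → Form k

Sat : ∀ {k} (L : LTS k) → Fin (states L) → Form k → Set
Sat L p tt = ⊤
Sat L p ff = ⊥
Sat L p (φ ∧' ψ) = Sat L p φ × Sat L p ψ
Sat L p (φ ∨' ψ) = Sat L p φ ⊎ Sat L p ψ
Sat L p (⟨ a ⟩ φ) = ∃[ p' ] (L ⊢ p ─[ a ]→ p' × Sat L p' φ)
Sat L p [ a ]ff = ∀ p' → ¬ (L ⊢ p ─[ a ]→ p')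

-- Membership X ∈ I(φ), for I(φ) ⊆ 2^A as defined inductively.
-- Clause for ⟨a⟩φ: empty if I(φ) = ∅, otherwise {X | a ∈ X};
-- i.e. X ∈ I(⟨a⟩φ) iff I(φ) is nonempty and a ∈ X.
_∈I_ : ∀ {k} → Subset (suc k) → Form k → Set
X ∈I tt = ⊤
X ∈I ff = ⊥
X ∈I (φ ∧' ψ) = X ∈I φ × X ∈I ψ
X ∈I (φ ∨' ψ) = X ∈I φ ⊎ X ∈I ψ
X ∈I (⟨ a ⟩ φ) = (∃[ Y ] (Y ∈I φ)) × (a ∈ X)
X ∈I [ a ]ff = a ∉ X

IEmpty : ∀ {k} → Form k → Set
IEmpty φ = ∀ X → ¬ (X ∈I φ)

Unsat : ∀ {k} → Form k → Set
Unsat {k} φ = (L : LTS k) (p : Fin (states L)) → ¬ Sat L p φ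

-- Two facts drive the proof. First, I(φ) is sound: whether p ⊨ φ depends only
-- on the initials of p and, for ⟨a⟩ψ, on some a-successor satisfying ψ, whose
-- own initials then lie in I(ψ). Second, there is a single universal LTS with
-- one state for each subset S ⊆ A, having initials S and an a-transition to
-- every state whenever a ∈ S; there the state S satisfies φ whenever S ∈ I(φ).
-- Part (b) then follows from (a), as every process has some set of initials.
module Submission where

open import Defs
open import Data.Nat using (ℕ; suc; _^_)
open import Data.Fin using (Fin; finToFun; funToFin)
open import Data.Fin.Properties using (any?; 2↔Bool; finToFun-funToFin)
open import Data.Fin.Subset using (Subset; _∈_)
open import Data.Bool using (Bool; true; _≟_)
open import Data.Vec using (lookup; tabulate)
open import Data.Vec.Properties
  using ([]=⇒lookup; lookup⇒[]=; lookup∘tabulate; tabulate∘lookup; tabulate-cong)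
open import Data.Product using (_×_; ∃-syntax; Σ-syntax; _,_)
open import Data.Sum using (inj₁; inj₂)
open import Data.Unit using (tt)
open import Data.Empty using (⊥-elim)
open import Function using (_∘_; const)
open import Function.Bundles using (_⇔_; mk⇔; Equivalence; Inverse)
open import Function.Construct.Composition using (_⇔-∘_)
open import Relation.Nullary using (Dec; yes; no; does)
open import Relation.Binary.PropositionalEquality
  using (_≡_; refl; sym; cong; subst; module ≡-Reasoning)

private
  variable
    k n : ℕ

∈⇔lookup≡true : {S : Subset n} {a : Fin n} → a ∈ S ⇔ lookup S a ≡ true
∈⇔lookup≡true {S = S} {a} = mk⇔ []=⇒lookup (lookup⇒[]= a S)

∈-tabulate⇔ : (f : Fin n → Bool) {a : Fin n} → a ∈ tabulate f ⇔ f a ≡ true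
∈-tabulate⇔ f {a} =
  subst (λ b → a ∈ tabulate f ⇔ b ≡ true) (lookup∘tabulate f a) ∈⇔lookup≡true

does≡true⇔ : {P : Set} (P? : Dec P) → does P? ≡ true ⇔ P
does≡true⇔ (yes p)  = mk⇔ (const p) (const refl)
does≡true⇔ (no ¬p) = mk⇔ (λ ()) (⊥-elim ∘ ¬p)

can-step? : (L : LTS k) (p : Fin (states L)) (a : Act k) → Dec (∃[ q ] (L ⊢ p ─[ a ]→ q))
can-step? L p a = any? (λ q → step L p a q ≟ true)

initials : (L : LTS k) → Fin (states L) → Subset (suc k)
initials L p = tabulate (does ∘ can-step? L p)

initials-correct : (L : LTS k) (p : Fin (states L)) → InitialsEq L p (initials L p)
initials-correct L p a = does≡true⇔ (can-step? L p a) ⇔-∘ ∈-tabulate⇔ (does ∘ can-step? L p)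

Sat⇒∈I : {L : LTS k} {p : Fin (states L)} {S : Subset (suc k)} (φ : Form k) →
         InitialsEq L p S → Sat L p φ → S ∈I φ
Sat⇒∈I tt       I⟨p⟩ _               = tt
Sat⇒∈I (φ ∧' ψ) I⟨p⟩ (p⊨φ , p⊨ψ)     = Sat⇒∈I φ I⟨p⟩ p⊨φ , Sat⇒∈I ψ I⟨p⟩ p⊨ψ
Sat⇒∈I (φ ∨' ψ) I⟨p⟩ (inj₁ p⊨φ)      = inj₁ (Sat⇒∈I φ I⟨p⟩ p⊨φ)
Sat⇒∈I (φ ∨' ψ) I⟨p⟩ (inj₂ p⊨ψ)      = inj₂ (Sat⇒∈I ψ I⟨p⟩ p⊨ψ)
Sat⇒∈I {L = L} (⟨ a ⟩ φ) I⟨p⟩ (q , p→q , q⊨φ) =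
  (initials L q , Sat⇒∈I φ (initials-correct L q) q⊨φ) ,
  Equivalence.from (I⟨p⟩ a) (q , p→q)
Sat⇒∈I [ a ]ff  I⟨p⟩ p↛ a∈S with Equivalence.to (I⟨p⟩ a) a∈S
... | q , p→q = p↛ q p→q

decode : Fin (2 ^ n) → Subset n
decode i = tabulate (Inverse.to 2↔Bool ∘ finToFun i)

encode : Subset n → Fin (2 ^ n)
encode S = funToFin (Inverse.from 2↔Bool ∘ lookup S)

decode∘encode : (S : Subset n) → decode (encode S) ≡ S
decode∘encode S = begin
  tabulate (to ∘ finToFun (funToFin (from ∘ lookup S)))
    ≡⟨ tabulate-cong (cong to ∘ finToFun-funToFin (from ∘ lookup S)) ⟩
  tabulate (to ∘ from ∘ lookup S)
    ≡⟨ tabulate-cong (Inverse.strictlyInverseˡ 2↔Bool ∘ lookup S) ⟩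
  tabulate (lookup S)
    ≡⟨ tabulate∘lookup S ⟩
  S ∎
  where
  open ≡-Reasoning
  open Inverse 2↔Bool using (to; from)

universal : (k : ℕ) → LTS k
universal k = record
  { states = 2 ^ suc k
  ; step   = λ i a _ → lookup (decode i) a
  }

universal-initials : (i : Fin (2 ^ suc k)) → InitialsEq (universal k) i (decode i)
universal-initials i a =
  mk⇔ (λ a∈ → i , []=⇒lookup a∈) (λ (_ , i→j) → lookup⇒[]= a (decode i) i→j)

∈I⇒Sat-universal : (φ : Form k) (i : Fin (2 ^ suc k)) →
                   decode i ∈I φ → Sat (universal k) i φ
∈I⇒Sat-universal tt       i _                 = tt
∈I⇒Sat-universal (φ ∧' ψ) i (i∈φ , i∈ψ)       =
  ∈I⇒Sat-universal φ i i∈φ , ∈I⇒Sat-universal ψ i i∈ψ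
∈I⇒Sat-universal (φ ∨' ψ) i (inj₁ i∈φ)        = inj₁ (∈I⇒Sat-universal φ i i∈φ)
∈I⇒Sat-universal (φ ∨' ψ) i (inj₂ i∈ψ)        = inj₂ (∈I⇒Sat-universal ψ i i∈ψ)
∈I⇒Sat-universal (⟨ a ⟩ φ) i ((Y , Y∈φ) , a∈) =
  encode Y , []=⇒lookup a∈ ,
  ∈I⇒Sat-universal φ (encode Y) (subst (_∈I φ) (sym (decode∘encode Y)) Y∈φ)
∈I⇒Sat-universal [ a ]ff  i a∉ j i→j          = a∉ (lookup⇒[]= a (decode i) i→j)

Realisable : Subset (suc k) → Form k → Set
Realisable {k} S φ = Σ[ L ∈ LTS k ] Σ[ p ∈ Fin (states L) ] (InitialsEq L p S × Sat L p φ)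

∈I⇒Realisable : {S : Subset (suc k)} (φ : Form k) → S ∈I φ → Realisable S φ
∈I⇒Realisable {k} {S} φ S∈φ =
  universal k , encode S ,
  subst (InitialsEq (universal k) (encode S)) (decode∘encode S) (universal-initials (encode S)) ,
  ∈I⇒Sat-universal φ (encode S) (subst (_∈I φ) (sym (decode∘encode S)) S∈φ)

lemma15 : {k : ℕ} (φ : Form k) →
    ((S : Subset (suc k)) →
      (S ∈I φ) ⇔ (Σ[ L ∈ LTS k ] Σ[ p ∈ Fin (states L) ] (InitialsEq L p S × Sat L p φ)))
    × (Unsat φ ⇔ IEmpty φ)
lemma15 φ =
  (λ S → mk⇔ (∈I⇒Realisable φ) (λ (_ , _ , I⟨p⟩ , p⊨φ) → Sat⇒∈I φ I⟨p⟩ p⊨φ)) ,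
  mk⇔ (λ unsat S S∈φ → let (L , p , _ , p⊨φ) = ∈I⇒Realisable φ S∈φ in unsat L p p⊨φ)
      (λ empty L p p⊨φ → empty (initials L p) (Sat⇒∈I φ (initials-correct L p) p⊨φ))
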